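{- Let $A\subseteq\mathbb{Z}_m$ be non-empty with $n:=|A|$, and let $a_1<a_2<\ldots<a_n$ be its elements (as integers in $\{0,\ldots,m-1\}$); set $a_{n+j}:=a_j$ for $1\le j\le n$. Define the string $P$ of length $n$ by $P_i:=(a_{i+1}-a_i)\bmod m$ for $1\le i\le n$, and the string $T$ of length $2n-1$ by $T_i:=(a_{i+1}-a_i)\bmod m$ for $1\le i\le 2n-1$. Say $P$ matches $T$ at position $i$ if $P_j=T_{i-1+j}$ for all $1\le j\le n$. Then: if there is a match of $P$ in $T$ at position $i$, then $(a_i-a_1)\bmod m\in Sym(A)$. Moreover, for every $x\in Sym(A)$ there is some $1\le i\le n$ with $x=(a_i-a_1)\bmod m$ such that there is a match of $P$ in $T$ at position $i$.
   Context: For $A\subseteq\mathbb{Z}_m$, $Sym(A)=\{h\in\mathbb{Z}_m: A+\{h\}=A\}$, where $A+\{h\}=\{a+h\bmod m: a\in A\}$. -}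

module Defs where

open import Data.Nat using (ℕ; suc; _+_; _<_; NonZero; _%_)
open import Data.Nat.DivMod using (m%n<n)
open import Data.Fin using (Fin; toℕ; fromℕ<)
import Data.Fin as F
open import Data.Integer using (ℤ; +_; _-_)
open import Data.Integer.DivMod using (_%ℕ_)
open import Data.Product using (Σ; ∃; _×_)
open import Relation.Binary.PropositionalEquality using (_≡_)
open import Function.Bundles using (_⇔_)

-- Elements of ℤ_m are represented by their canonical representatives
-- x ∈ {0,…,m-1} ⊆ ℕ; a subset of ℤ_m is a predicate on ℕ.

_⊖_mod_ : ℕ → ℕ → (m : ℕ) → .{{NonZero m}} → ℕ
x ⊖ y mod m = ((+ x) - (+ y)) %ℕ m

shift : (m : ℕ) → .{{NonZero m}} → (ℕ → Set) → ℕ → (ℕ → Set)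
shift m A h x = ∃ λ y → A y × ((y + h) % m ≡ x)

Sym : (m : ℕ) → .{{NonZero m}} → (ℕ → Set) → ℕ → Set
Sym m A h = h < m × (∀ x → shift m A h x ⇔ A x)

Image : ∀ {n} → (Fin n → ℕ) → ℕ → Set
Image {n} a x = ∃ λ (i : Fin n) → a i ≡ x

StrictlyIncreasing : ∀ {n} → (Fin n → ℕ) → Set
StrictlyIncreasing {n} a = ∀ (i j : Fin n) → i F.< j → a i < a j

-- cyclic extension: a_{n+j} := a_j  (0-based: ext k = a (k mod n))
ext : ∀ {n} → .{{NonZero n}} → (Fin n → ℕ) → ℕ → ℕ
ext {n} a k = a (fromℕ< (m%n<n k n))

Pstr : (m : ℕ) → .{{NonZero m}} → ∀ {n} → .{{NonZero n}} → (Fin n → ℕ) → Fin n → ℕ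
Pstr m a i = ext a (suc (toℕ i)) ⊖ ext a (toℕ i) mod m

-- T_i := (a_{i+1} - a_i) mod m, length 2n-1 = n + (n-1)
Tstr : (m : ℕ) → .{{NonZero m}} → ∀ n' → (Fin (suc n') → ℕ) → Fin (suc n' + n') → ℕ
Tstr m n' a i = ext a (suc (toℕ i)) ⊖ ext a (toℕ i) mod m

-- string P (length k) matches T (length l) at 0-based position i:
-- P_j = T_{i+j} for all j, with all these positions inside T
MatchesAt : ∀ {k l} → (Fin k → ℕ) → (Fin l → ℕ) → ℕ → Set
MatchesAt {k} {l} P T i =
  ∀ (j : Fin k) → Σ (i + toℕ j < l) λ h → P j ≡ T (fromℕ< h)

-- Index A cyclically and let g_k = (a_{k+1} - a_k) mod m be its gaps.  If P occurs in T at
-- position i, the gaps repeat with offset i - 1, so by induction on j adding h = a_i - a_1 carries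
-- every a_j to a_{i+j-1}, and hence maps A onto A.  Conversely, h ∈ Sym(A) carries a_1 to some
-- a_i.  Adding h preserves the distance (y - x) mod m, and g_j is the least positive distance
-- from a_j to another element of A, so h carries the successor of a_j to the successor of its
-- image; thus again a_j ↦ a_{i+j-1}, and the gaps repeat with offset i - 1.
module Submission where

open import Algebra.Properties.CommutativeSemigroup using (xy∙z≈xz∙y; x∙yz≈y∙xz)
open import Data.Fin using (Fin; toℕ; fromℕ<; zero)
open import Data.Fin.Properties using (toℕ<n; toℕ-fromℕ<; fromℕ<-toℕ; fromℕ<-cong)
open import Data.Integer using (+_; -[1+_]; -_; _-_)
open import Data.Integer.DivMod using (_%ℕ_)
import Data.Integer.Properties as ℤ
open import Data.Nat
open import Data.Nat.DivMod
open import Data.Nat.Properties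
open import Data.Product using (Σ; ∃; _×_; _,_)
open import Data.Sum using (inj₁; inj₂; [_,_]′)
open import Function.Base using (_∘_)
open import Function.Bundles using (mk⇔; Equivalence)
open import Relation.Binary using (tri<; tri≈; tri>)
open import Relation.Binary.PropositionalEquality
open import Relation.Nullary using (yes; no; contradiction)

open import Defs

module Modular (m : ℕ) .{{_ : NonZero m}} where

  infixl 6 _⊕_

  _⊕_ : ℕ → ℕ → ℕ
  x ⊕ y = (x + y) % m

  -- (y - x) mod m, arranged so that the truncated subtraction is harmless whenever x ≤ m.
  dist : ℕ → ℕ → ℕ
  dist x y = (m ∸ x + y) % m

  dist<m : ∀ x y → dist x y < m
  dist<m x y = m%n<n (m ∸ x + y) m

  [x%m+y]%m≡[x+y]%m : ∀ x y → (x % m + y) % m ≡ (x + y) % m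
  [x%m+y]%m≡[x+y]%m x y = begin
    (x % m + y) % m          ≡⟨ %-distribˡ-+ (x % m) y m ⟩
    (x % m % m + y % m) % m  ≡⟨ cong (λ z → (z + y % m) % m) (m%n%n≡m%n x m) ⟩
    (x % m + y % m) % m      ≡⟨ %-distribˡ-+ x y m ⟨
    (x + y) % m              ∎
    where open ≡-Reasoning

  [x+y%m]%m≡[x+y]%m : ∀ x y → (x + y % m) % m ≡ (x + y) % m
  [x+y%m]%m≡[x+y]%m x y = begin
    (x + y % m) % m  ≡⟨ cong (_% m) (+-comm x (y % m)) ⟩
    (y % m + x) % m  ≡⟨ [x%m+y]%m≡[x+y]%m y x ⟩
    (y + x) % m      ≡⟨ cong (_% m) (+-comm y x) ⟩
    (x + y) % m      ∎
    where open ≡-Reasoning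

  ⊕-right-comm : ∀ x y z → x ⊕ y ⊕ z ≡ x ⊕ z ⊕ y
  ⊕-right-comm x y z = begin
    x ⊕ y ⊕ z        ≡⟨ [x%m+y]%m≡[x+y]%m (x + y) z ⟩
    (x + y + z) % m  ≡⟨ cong (_% m) (xy∙z≈xz∙y +-commutativeSemigroup x y z) ⟩
    (x + z + y) % m  ≡⟨ [x%m+y]%m≡[x+y]%m (x + z) y ⟨
    x ⊕ z ⊕ y        ∎
    where open ≡-Reasoning

  [m+y]%m≡y : ∀ {y} → y < m → (m + y) % m ≡ y
  [m+y]%m≡y {y} y<m = trans (cong (_% m) (+-comm m y)) (trans ([m+n]%n≡m%n y m) (m<n⇒m%n≡m y<m))

  ⊕-dist : ∀ {x y} → x ≤ m → y < m → x ⊕ dist x y ≡ y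
  ⊕-dist {x} {y} x≤m y<m = begin
    x ⊕ dist x y             ≡⟨ [x+y%m]%m≡[x+y]%m x (m ∸ x + y) ⟩
    (x + (m ∸ x + y)) % m    ≡⟨ cong (_% m) (+-assoc x (m ∸ x) y) ⟨
    (x + (m ∸ x) + y) % m    ≡⟨ cong (λ z → (z + y) % m) (m+[n∸m]≡n x≤m) ⟩
    (m + y) % m              ≡⟨ [m+y]%m≡y y<m ⟩
    y                        ∎
    where open ≡-Reasoning

  dist-unique : ∀ {x y d} → x ≤ m → d < m → x ⊕ d ≡ y → dist x y ≡ d
  dist-unique {x} {y} {d} x≤m d<m x⊕d≡y = begin
    (m ∸ x + y) % m           ≡⟨ cong (λ z → (m ∸ x + z) % m) x⊕d≡y ⟨
    (m ∸ x + (x ⊕ d)) % m     ≡⟨ [x+y%m]%m≡[x+y]%m (m ∸ x) (x + d) ⟩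
    (m ∸ x + (x + d)) % m     ≡⟨ cong (_% m) (+-assoc (m ∸ x) x d) ⟨
    (m ∸ x + x + d) % m       ≡⟨ cong (λ z → (z + d) % m) (m∸n+n≡m x≤m) ⟩
    (m + d) % m               ≡⟨ [m+y]%m≡y d<m ⟩
    d                         ∎
    where open ≡-Reasoning

  dist-injectiveʳ : ∀ {x y z} → x ≤ m → y < m → z < m → dist x y ≡ dist x z → y ≡ z
  dist-injectiveʳ {x} {y} {z} x≤m y<m z<m eq = begin
    y             ≡⟨ ⊕-dist x≤m y<m ⟨
    x ⊕ dist x y  ≡⟨ cong (x ⊕_) eq ⟩
    x ⊕ dist x z  ≡⟨ ⊕-dist x≤m z<m ⟩
    z             ∎
    where open ≡-Reasoning

  dist-self : ∀ {x} → x ≤ m → dist x x ≡ 0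
  dist-self {x} x≤m = trans (cong (_% m) (m∸n+n≡m x≤m)) (n%n≡0 m)

  dist≡0⇒≡ : ∀ {x y} → x < m → y < m → dist x y ≡ 0 → y ≡ x
  dist≡0⇒≡ x<m y<m eq =
    dist-injectiveʳ (<⇒≤ x<m) y<m x<m (trans eq (sym (dist-self (<⇒≤ x<m))))

  dist-⊕ : ∀ {u v} x → u < m → v < m → dist (u ⊕ x) (v ⊕ x) ≡ dist u v
  dist-⊕ {u} {v} x u<m v<m = dist-unique (m%n≤n (u + x) m) (dist<m u v) (begin
    u ⊕ x ⊕ dist u v  ≡⟨ ⊕-right-comm u x (dist u v) ⟩
    u ⊕ dist u v ⊕ x  ≡⟨ cong (_⊕ x) (⊕-dist (<⇒≤ u<m) v<m) ⟩
    v ⊕ x             ∎)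
    where open ≡-Reasoning

  dist-≤ : ∀ {x y} → x ≤ y → y < m → dist x y ≡ y ∸ x
  dist-≤ {x} {y} x≤y y<m = begin
    (m ∸ x + y) % m             ≡⟨ cong (λ z → (m ∸ x + z) % m) (m+[n∸m]≡n x≤y) ⟨
    (m ∸ x + (x + (y ∸ x))) % m ≡⟨ cong (_% m) (+-assoc (m ∸ x) x (y ∸ x)) ⟨
    (m ∸ x + x + (y ∸ x)) % m   ≡⟨ cong (λ z → (z + (y ∸ x)) % m) (m∸n+n≡m (≤-trans x≤y (<⇒≤ y<m))) ⟩
    (m + (y ∸ x)) % m           ≡⟨ [m+y]%m≡y (≤-<-trans (m∸n≤m y x) y<m) ⟩
    y ∸ x                       ∎
    where open ≡-Reasoning

  dist-> : ∀ {x y} → y < x → x ≤ m → dist x y ≡ m ∸ x + y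
  dist-> {x} {y} y<x x≤m =
    m<n⇒m%n≡m (subst (m ∸ x + y <_) (m∸n+n≡m x≤m) (+-monoʳ-< (m ∸ x) y<x))

  ⊖-mod≡dist : ∀ {x y} → x < m → y < m → x ⊖ y mod m ≡ dist y x
  ⊖-mod≡dist {x} {y} x<m y<m with ≤-<-connex y x
  ... | inj₁ y≤x = begin
    (+ x - + y) %ℕ m  ≡⟨ cong (_%ℕ m) (trans (ℤ.m-n≡m⊖n x y) (ℤ.⊖-≥ y≤x)) ⟩
    (x ∸ y) % m       ≡⟨ m<n⇒m%n≡m (≤-<-trans (m∸n≤m x y) x<m) ⟩
    x ∸ y             ≡⟨ dist-≤ y≤x x<m ⟨
    dist y x          ∎
    where open ≡-Reasoning
  ... | inj₂ x<y = begin
    (+ x - + y) %ℕ m  ≡⟨ cong (_%ℕ m) (trans (ℤ.m-n≡m⊖n x y) (ℤ.⊖-< x<y)) ⟩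
    - (+ (y ∸ x)) %ℕ m ≡⟨ cong (λ z → - (+ z) %ℕ m) k+1≡y∸x ⟨
    -[1+ k ] %ℕ m     ≡⟨ negative%m (subst (_< m) (sym k+1≡y∸x) (≤-<-trans (m∸n≤m y x) y<m)) ⟩
    m ∸ suc k         ≡⟨ cong (m ∸_) k+1≡y∸x ⟩
    m ∸ (y ∸ x)       ≡⟨ m∸[y∸x]≡m∸y+x ⟩
    m ∸ y + x         ≡⟨ dist-> x<y (<⇒≤ y<m) ⟨
    dist y x          ∎
    where
    open ≡-Reasoning
    k = y ∸ suc x
    k+1≡y∸x : suc k ≡ y ∸ x
    k+1≡y∸x = sym (+-∸-assoc 1 x<y)
    negative%m : ∀ {k} → suc k < m → -[1+ k ] %ℕ m ≡ m ∸ suc k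
    negative%m k+1<m rewrite m<n⇒m%n≡m k+1<m = refl
    m∸[y∸x]≡m∸y+x : m ∸ (y ∸ x) ≡ m ∸ y + x
    m∸[y∸x]≡m∸y+x = begin
      m ∸ (y ∸ x)                      ≡⟨ cong (_∸ (y ∸ x)) m∸y+x+[y∸x]≡m ⟨
      m ∸ y + x + (y ∸ x) ∸ (y ∸ x)    ≡⟨ m+n∸n≡m (m ∸ y + x) (y ∸ x) ⟩
      m ∸ y + x                        ∎
      where
      m∸y+x+[y∸x]≡m : m ∸ y + x + (y ∸ x) ≡ m
      m∸y+x+[y∸x]≡m = trans (+-assoc (m ∸ y) x (y ∸ x))
        (trans (cong (_+_ (m ∸ y)) (m+[n∸m]≡n (<⇒≤ x<y))) (m∸n+n≡m (<⇒≤ y<m)))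

module CyclicGaps (m : ℕ) .{{_ : NonZero m}} (n' : ℕ) (a : Fin (suc n') → ℕ)
                  (a<m : ∀ i → a i < m) (a-increasing : StrictlyIncreasing a) where

  open Modular m

  n : ℕ
  n = suc n'

  ext<m : ∀ k → ext a k < m
  ext<m k = a<m _

  ext-cong : ∀ k l → k % n ≡ l % n → ext a k ≡ ext a l
  ext-cong k l eq = cong a (fromℕ<-cong _ _ eq (m%n<n k n) (m%n<n l n))

  ext-< : ∀ k l → k % n < l % n → ext a k < ext a l
  ext-< k l lt = a-increasing _ _
    (subst₂ _<_ (sym (toℕ-fromℕ< (m%n<n k n))) (sym (toℕ-fromℕ< (m%n<n l n))) lt)

  ext-≤ : ∀ k l → k % n ≤ l % n → ext a k ≤ ext a l
  ext-≤ k l le with m≤n⇒m<n∨m≡n le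
  ... | inj₁ lt = <⇒≤ (ext-< k l lt)
  ... | inj₂ eq = ≤-reflexive (ext-cong k l eq)

  ext-toℕ : ∀ (i : Fin n) → ext a (toℕ i) ≡ a i
  ext-toℕ i = cong a (trans (fromℕ<-cong _ _ (m<n⇒m%n≡m (toℕ<n i)) (m%n<n (toℕ i) n) (toℕ<n i))
                            (fromℕ<-toℕ i (toℕ<n i)))

  ext∈Image : ∀ k → Image a (ext a k)
  ext∈Image k = fromℕ< (m%n<n k n) , refl

  Image⇒ext : ∀ {y} → Image a y → ∃ λ k → ext a k ≡ y
  Image⇒ext (i , ai≡y) = toℕ i , trans (ext-toℕ i) ai≡y

  ext-constant : n' ≡ 0 → ∀ k l → ext a k ≡ ext a l
  ext-constant n'≡0 k l = ext-cong k l (trans (%n≡0 k) (sym (%n≡0 l)))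
    where
    %n≡0 : ∀ k → k % n ≡ 0
    %n≡0 k = n<1⇒n≡0 (subst (k % n <_) (cong suc n'≡0) (m%n<n k n))

  suc-%-cong : ∀ k l → k % n ≡ l % n → suc k % n ≡ suc l % n
  suc-%-cong k l eq = begin
    suc k % n            ≡⟨ Modular.[x+y%m]%m≡[x+y]%m n 1 k ⟨
    suc (k % n) % n      ≡⟨ cong (λ r → suc r % n) eq ⟩
    suc (l % n) % n      ≡⟨ Modular.[x+y%m]%m≡[x+y]%m n 1 l ⟩
    suc l % n            ∎
    where open ≡-Reasoning

  suc-%-inner : ∀ {j} → suc (j % n) < n → suc j % n ≡ suc (j % n)
  suc-%-inner {j} inner = trans (sym (Modular.[x+y%m]%m≡[x+y]%m n 1 j)) (m<n⇒m%n≡m inner)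

  suc-%-wrap : ∀ {j} → suc (j % n) ≡ n → suc j % n ≡ 0
  suc-%-wrap {j} wrap =
    trans (sym (Modular.[x+y%m]%m≡[x+y]%m n 1 j)) (trans (cong (_% n) wrap) (n%n≡0 n))

  ext-<-suc : ∀ {j} → suc (j % n) < n → ext a j < ext a (suc j)
  ext-<-suc {j} inner = ext-< j (suc j) (subst (j % n <_) (sym (suc-%-inner inner)) ≤-refl)

  gap : ℕ → ℕ
  gap k = dist (ext a k) (ext a (suc k))

  gap-cong : ∀ k l → k % n ≡ l % n → gap k ≡ gap l
  gap-cong k l eq = cong₂ dist (ext-cong k l eq) (ext-cong (suc k) (suc l) (suc-%-cong k l eq))

  ⊖-ext≡gap : ∀ k → ext a (suc k) ⊖ ext a k mod m ≡ gap k
  ⊖-ext≡gap k = ⊖-mod≡dist (ext<m (suc k)) (ext<m k)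

  ext-suc≡ext⊕gap : ∀ k → ext a (suc k) ≡ ext a k ⊕ gap k
  ext-suc≡ext⊕gap k = sym (⊕-dist (<⇒≤ (ext<m k)) (ext<m (suc k)))

  ext-suc≢ext : 0 < n' → ∀ j → ext a (suc j) ≢ ext a j
  ext-suc≢ext 0<n' j with m≤n⇒m<n∨m≡n (m%n<n j n)
  ... | inj₁ inner = λ eq → <⇒≢ (ext-<-suc inner) (sym eq)
  ... | inj₂ wrap  =
    <⇒≢ (ext-< (suc j) j (subst₂ _<_ (sym (suc-%-wrap wrap)) (sym (suc-injective wrap)) 0<n'))

  gap-pos : 0 < n' → ∀ j → 0 < gap j
  gap-pos 0<n' j =
    n≢0⇒n>0 λ gap≡0 → ext-suc≢ext 0<n' j (dist≡0⇒≡ (ext<m j) (ext<m (suc j)) gap≡0)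

  gap-minimal-inner : ∀ j k → ext a k ≢ ext a j → suc (j % n) < n
                    → gap j ≤ dist (ext a j) (ext a k)
  gap-minimal-inner j k k≢j inner with <-cmp (k % n) (j % n)
  ... | tri< k<j _ _ = begin
    gap j                      ≡⟨ dist-≤ (<⇒≤ (ext-<-suc inner)) (ext<m (suc j)) ⟩
    ext a (suc j) ∸ ext a j    ≤⟨ ∸-monoˡ-≤ (ext a j) (<⇒≤ (ext<m (suc j))) ⟩
    m ∸ ext a j                ≤⟨ m≤m+n (m ∸ ext a j) (ext a k) ⟩
    m ∸ ext a j + ext a k      ≡⟨ dist-> (ext-< k j k<j) (<⇒≤ (ext<m j)) ⟨
    dist (ext a j) (ext a k)   ∎
    where open ≤-Reasoning
  ... | tri≈ _ k≡j _ = contradiction (ext-cong k j k≡j) k≢j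
  ... | tri> _ _ j<k = begin
    gap j                      ≡⟨ dist-≤ (<⇒≤ (ext-<-suc inner)) (ext<m (suc j)) ⟩
    ext a (suc j) ∸ ext a j    ≤⟨ ∸-monoˡ-≤ (ext a j) suc-j≤k ⟩
    ext a k ∸ ext a j          ≡⟨ dist-≤ (ext-≤ j k (<⇒≤ j<k)) (ext<m k) ⟨
    dist (ext a j) (ext a k)   ∎
    where
    open ≤-Reasoning
    suc-j≤k : ext a (suc j) ≤ ext a k
    suc-j≤k = ext-≤ (suc j) k (subst (_≤ k % n) (sym (suc-%-inner inner)) j<k)

  gap-minimal-wrap : ∀ j k → ext a k ≢ ext a j → suc (j % n) ≡ n
                   → gap j ≤ dist (ext a j) (ext a k)
  gap-minimal-wrap j k k≢j wrap = begin
    gap j                          ≡⟨ dist-> (≤-<-trans suc-j≤k k<j) (<⇒≤ (ext<m j)) ⟩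
    m ∸ ext a j + ext a (suc j)    ≤⟨ +-monoʳ-≤ (m ∸ ext a j) suc-j≤k ⟩
    m ∸ ext a j + ext a k          ≡⟨ dist-> k<j (<⇒≤ (ext<m j)) ⟨
    dist (ext a j) (ext a k)       ∎
    where
    open ≤-Reasoning
    k<j : ext a k < ext a j
    k<j = ext-< k j (≤∧≢⇒< (s≤s⁻¹ (subst (k % n <_) (sym wrap) (m%n<n k n)))
                       (λ k≡j → k≢j (ext-cong k j k≡j)))
    suc-j≤k : ext a (suc j) ≤ ext a k
    suc-j≤k = ext-≤ (suc j) k (subst (_≤ k % n) (sym (suc-%-wrap wrap)) z≤n)

  gap-minimal : ∀ j k → 0 < dist (ext a j) (ext a k) → gap j ≤ dist (ext a j) (ext a k)
  gap-minimal j k pos =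
    [ gap-minimal-inner j k k≢j , gap-minimal-wrap j k k≢j ]′ (m≤n⇒m<n∨m≡n (m%n<n j n))
    where
    k≢j : ext a k ≢ ext a j
    k≢j k≡j = <⇒≢ pos (sym (trans (cong (dist (ext a j)) k≡j) (dist-self (<⇒≤ (ext<m j)))))

  GapsRepeatAt : ℕ → Set
  GapsRepeatAt i = ∀ j → gap j ≡ gap (i + j)

  matches⇒gapsRepeat : ∀ {i} → MatchesAt (Pstr m a) (Tstr m n' a) i → GapsRepeatAt i
  matches⇒gapsRepeat {i} match j with match (fromℕ< (m%n<n j n))
  ... | in-T , Pj≡Ti+j = begin
    gap j                              ≡⟨ gap-cong j (toℕ j′) j%n≡j′%n ⟩
    gap (toℕ j′)                       ≡⟨ ⊖-ext≡gap (toℕ j′) ⟨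
    Pstr m a j′                        ≡⟨ Pj≡Ti+j ⟩
    Tstr m n' a (fromℕ< in-T)          ≡⟨ ⊖-ext≡gap (toℕ (fromℕ< in-T)) ⟩
    gap (toℕ (fromℕ< in-T))            ≡⟨ cong gap (toℕ-fromℕ< in-T) ⟩
    gap (i + toℕ j′)                   ≡⟨ gap-cong (i + toℕ j′) (i + j) i+j%n≡i+j ⟩
    gap (i + j)                        ∎
    where
    open ≡-Reasoning
    j′ = fromℕ< (m%n<n j n)
    j%n≡j′%n : j % n ≡ toℕ j′ % n
    j%n≡j′%n = sym (trans (cong (_% n) (toℕ-fromℕ< (m%n<n j n))) (m%n%n≡m%n j n))
    i+j%n≡i+j : (i + toℕ j′) % n ≡ (i + j) % n
    i+j%n≡i+j = trans (cong (λ r → (i + r) % n) (toℕ-fromℕ< (m%n<n j n)))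
                      (Modular.[x+y%m]%m≡[x+y]%m n i j)

  gapsRepeat⇒matches : ∀ {i} → i < n → GapsRepeatAt i → MatchesAt (Pstr m a) (Tstr m n' a) i
  gapsRepeat⇒matches {i} i<n repeats j = in-T , (begin
    Pstr m a j                 ≡⟨ ⊖-ext≡gap (toℕ j) ⟩
    gap (toℕ j)                ≡⟨ repeats (toℕ j) ⟩
    gap (i + toℕ j)            ≡⟨ cong gap (toℕ-fromℕ< in-T) ⟨
    gap (toℕ (fromℕ< in-T))    ≡⟨ ⊖-ext≡gap (toℕ (fromℕ< in-T)) ⟨
    Tstr m n' a (fromℕ< in-T)  ∎)
    where
    open ≡-Reasoning
    in-T : i + toℕ j < n + n'
    in-T = +-mono-<-≤ i<n (s≤s⁻¹ (toℕ<n j))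

  Translates : ℕ → ℕ → Set
  Translates h i = ∀ j → ext a j ⊕ h ≡ ext a (i + j)

  translates⇒gapsRepeat : ∀ {h i} → Translates h i → GapsRepeatAt i
  translates⇒gapsRepeat {h} {i} translates j = begin
    gap j                                          ≡⟨ dist-⊕ h (ext<m j) (ext<m (suc j)) ⟨
    dist (ext a j ⊕ h) (ext a (suc j) ⊕ h)         ≡⟨ cong₂ dist (translates j) (translates (suc j)) ⟩
    dist (ext a (i + j)) (ext a (i + suc j))       ≡⟨ cong (dist (ext a (i + j)) ∘ ext a) (+-suc i j) ⟩
    gap (i + j)                                    ∎
    where open ≡-Reasoning

  gapsRepeat⇒translates : ∀ {i} → GapsRepeatAt i → Translates (dist (ext a 0) (ext a i)) i
  gapsRepeat⇒translates {i} repeats zero =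
    trans (⊕-dist (<⇒≤ (ext<m 0)) (ext<m i)) (cong (ext a) (sym (+-identityʳ i)))
  gapsRepeat⇒translates {i} repeats (suc j) = begin
    ext a (suc j) ⊕ h              ≡⟨ cong (_⊕ h) (ext-suc≡ext⊕gap j) ⟩
    ext a j ⊕ gap j ⊕ h            ≡⟨ ⊕-right-comm (ext a j) (gap j) h ⟩
    ext a j ⊕ h ⊕ gap j            ≡⟨ cong₂ _⊕_ (gapsRepeat⇒translates repeats j) (repeats j) ⟩
    ext a (i + j) ⊕ gap (i + j)    ≡⟨ ext-suc≡ext⊕gap (i + j) ⟨
    ext a (suc (i + j))            ≡⟨ cong (ext a) (+-suc i j) ⟨
    ext a (i + suc j)              ∎
    where
    open ≡-Reasoning
    h = dist (ext a 0) (ext a i)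

  translates⇒Sym : ∀ {h i} → h < m → i ≤ n → Translates h i → Sym m (Image a) h
  translates⇒Sym {h} {i} h<m i≤n translates = h<m , λ x → mk⇔ (shifted x) (unshifted x)
    where
    shifted : ∀ x → shift m (Image a) h x → Image a x
    shifted x (y , (k , ak≡y) , y⊕h≡x) = subst (Image a) i+k≡x (ext∈Image (i + toℕ k))
      where
      i+k≡x : ext a (i + toℕ k) ≡ x
      i+k≡x = trans (sym (translates (toℕ k)))
                    (trans (cong (_⊕ h) (trans (ext-toℕ k) ak≡y)) y⊕h≡x)
    unshifted : ∀ x → Image a x → shift m (Image a) h x
    unshifted x (k , ak≡x) = ext a j , ext∈Image j , (begin
      ext a j ⊕ h         ≡⟨ translates j ⟩
      ext a (i + j)       ≡⟨ cong (ext a) i+j≡k+n ⟩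
      ext a (toℕ k + n)   ≡⟨ ext-cong (toℕ k + n) (toℕ k) ([m+n]%n≡m%n (toℕ k) n) ⟩
      ext a (toℕ k)       ≡⟨ trans (ext-toℕ k) ak≡x ⟩
      x                   ∎)
      where
      open ≡-Reasoning
      j = toℕ k + (n ∸ i)
      i+j≡k+n : i + j ≡ toℕ k + n
      i+j≡k+n = trans (x∙yz≈y∙xz +-commutativeSemigroup i (toℕ k) (n ∸ i))
                      (cong (_+_ (toℕ k)) (m+[n∸m]≡n i≤n))

  Sym⇒ext-image : ∀ {h} → Sym m (Image a) h → ∀ j → ∃ λ k → ext a k ≡ ext a j ⊕ h
  Sym⇒ext-image (_ , A+h≡A) j =
    Image⇒ext (Equivalence.to (A+h≡A _) (ext a j , ext∈Image j , refl))

  Sym⇒ext-preimage : ∀ {h} → Sym m (Image a) h → ∀ k → ∃ λ j → ext a j ⊕ h ≡ ext a k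
  Sym⇒ext-preimage {h} (_ , A+h≡A) k with Equivalence.from (A+h≡A (ext a k)) (ext∈Image k)
  ... | y , y∈A , y⊕h≡k with Image⇒ext y∈A
  ... | j , j≡y = j , trans (cong (_⊕ h) j≡y) y⊕h≡k

  -- Distances are shift-invariant, so gap-minimal applied on both sides forces gap j ≡ gap k.
  translate-suc : ∀ {h j k} → Sym m (Image a) h → ext a j ⊕ h ≡ ext a k
                → ext a (suc j) ⊕ h ≡ ext a (suc k)
  translate-suc {h} {j} {k} symmetric j⊕h≡k
    with n' ≟ 0 | Sym⇒ext-image symmetric (suc j) | Sym⇒ext-preimage symmetric (suc k)
  ... | yes n'≡0 | t , t≡suc-j⊕h | _ = trans (sym t≡suc-j⊕h) (ext-constant n'≡0 t (suc k))
  ... | no n'≢0  | t , t≡suc-j⊕h | l , l⊕h≡suc-k =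
    trans (sym t≡suc-j⊕h)
          (dist-injectiveʳ (<⇒≤ (ext<m k)) (ext<m t) (ext<m (suc k))
                           (≤-antisym k-t≤k-suc-k k-suc-k≤k-t))
    where
    k-t≡gap-j : dist (ext a k) (ext a t) ≡ gap j
    k-t≡gap-j = trans (cong₂ dist (sym j⊕h≡k) t≡suc-j⊕h) (dist-⊕ h (ext<m j) (ext<m (suc j)))
    gap-k≡j-l : gap k ≡ dist (ext a j) (ext a l)
    gap-k≡j-l = trans (cong₂ dist (sym j⊕h≡k) (sym l⊕h≡suc-k)) (dist-⊕ h (ext<m j) (ext<m l))
    0<n' : 0 < n'
    0<n' = n≢0⇒n>0 n'≢0
    k-t≤k-suc-k : dist (ext a k) (ext a t) ≤ gap k
    k-t≤k-suc-k = subst₂ _≤_ (sym k-t≡gap-j) (sym gap-k≡j-l)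
                    (gap-minimal j l (subst (0 <_) gap-k≡j-l (gap-pos 0<n' k)))
    k-suc-k≤k-t : gap k ≤ dist (ext a k) (ext a t)
    k-suc-k≤k-t = gap-minimal k t (subst (0 <_) (sym k-t≡gap-j) (gap-pos 0<n' j))

  Sym⇒translates : ∀ {h i} → Sym m (Image a) h → ext a 0 ⊕ h ≡ ext a i → Translates h i
  Sym⇒translates {i = i} symmetric 0⊕h≡i zero = trans 0⊕h≡i (cong (ext a) (sym (+-identityʳ i)))
  Sym⇒translates {i = i} symmetric 0⊕h≡i (suc j) =
    trans (translate-suc {j = j} {i + j} symmetric (Sym⇒translates {i = i} symmetric 0⊕h≡i j))
          (cong (ext a) (sym (+-suc i j)))

  ⊖-mod≡dist-ext : ∀ i → a i ⊖ a zero mod m ≡ dist (ext a 0) (ext a (toℕ i))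
  ⊖-mod≡dist-ext i =
    trans (⊖-mod≡dist (a<m i) (a<m zero)) (cong₂ dist (sym (ext-toℕ zero)) (sym (ext-toℕ i)))

lemma17 : (m : ℕ) → .{{_ : NonZero m}} → (n' : ℕ) → (a : Fin (suc n') → ℕ)
    → (∀ i → a i < m) → StrictlyIncreasing a
    → ((i : Fin (suc n')) → MatchesAt (Pstr m a) (Tstr m n' a) (toℕ i)
         → Sym m (Image a) (a i ⊖ a zero mod m))
    × ((x : ℕ) → Sym m (Image a) x
         → Σ (Fin (suc n')) λ i → (x ≡ (a i ⊖ a zero mod m))
             × MatchesAt (Pstr m a) (Tstr m n' a) (toℕ i))
lemma17 m n' a a<m a-increasing = match⇒symmetry , symmetry⇒match
  where
  open Modular m
  open CyclicGaps m n' a a<m a-increasing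

  match⇒symmetry : (i : Fin n) → MatchesAt (Pstr m a) (Tstr m n' a) (toℕ i)
                 → Sym m (Image a) (a i ⊖ a zero mod m)
  match⇒symmetry i match = subst (Sym m (Image a)) (sym (⊖-mod≡dist-ext i))
    (translates⇒Sym (dist<m (ext a 0) (ext a (toℕ i))) (<⇒≤ (toℕ<n i))
      (gapsRepeat⇒translates (matches⇒gapsRepeat {toℕ i} match)))

  symmetry⇒match : (x : ℕ) → Sym m (Image a) x
                 → Σ (Fin n) λ i → (x ≡ (a i ⊖ a zero mod m))
                                   × MatchesAt (Pstr m a) (Tstr m n' a) (toℕ i)
  symmetry⇒match x symmetric@(x<m , A+x≡A)
    with Equivalence.to (A+x≡A _) (a zero , (zero , refl) , refl)
  ... | i , i≡0⊕x = i , x≡i⊖0 , gapsRepeat⇒matches (toℕ<n i)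
            (translates⇒gapsRepeat {x} {toℕ i} (Sym⇒translates {i = toℕ i} symmetric 0⊕x≡i))
    where
    0⊕x≡i : ext a 0 ⊕ x ≡ ext a (toℕ i)
    0⊕x≡i = trans (cong (_⊕ x) (ext-toℕ zero)) (trans (sym i≡0⊕x) (sym (ext-toℕ i)))
    x≡i⊖0 : x ≡ a i ⊖ a zero mod m
    x≡i⊖0 = sym (trans (⊖-mod≡dist-ext i) (dist-unique (<⇒≤ (ext<m 0)) x<m 0⊕x≡i))
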